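{- Let $H$ be a differential field with derivation $\partial$, extended componentwise to $H^v$, and let $k,s,v\geq 1$ be integers. Let $x_1,\dots,x_{s+1}\in H^v$, and for $j\ge 0$ put $X^j_w=(x_w,\partial x_w,\dots,\partial^j x_w)\in H^{v(j+1)}$. Assume that $X^{k-1}_1,\dots,X^{k-1}_s$ are linearly independent over $H$ and that $X^k_1,\dots,X^k_{s+1}$ are linearly dependent over $H$. Then $X^k_1,\dots,X^k_{s+1}$ are linearly dependent over the field of constants $H^{\partial=0}$. -}

module Defs where

open import Level using (Level; _⊔_) renaming (suc to lsuc)
open import Data.Nat using (ℕ; zero; suc)
open import Data.Fin using (Fin; toℕ)
open import Data.Product using (Σ; ∃; _×_; _,_)
open import Relation.Nullary using (¬_)
open import Algebra.Bundles using (CommutativeRing)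
import Algebra.Definitions.RawMonoid as RM

record Field (c ℓ : Level) : Set (lsuc (c ⊔ ℓ)) where
  field
    commutativeRing : CommutativeRing c ℓ
  open CommutativeRing commutativeRing public
  field
    0≉1     : ¬ (0# ≈ 1#)
    inverse : ∀ x → ¬ (x ≈ 0#) → Σ Carrier λ y → x * y ≈ 1#

record DifferentialField (c ℓ : Level) : Set (lsuc (c ⊔ ℓ)) where
  field
    field′ : Field c ℓ
  open Field field′ public
  field
    ∂       : Carrier → Carrier
    ∂-cong  : ∀ {x y} → x ≈ y → ∂ x ≈ ∂ y
    ∂-+     : ∀ x y → ∂ (x + y) ≈ ∂ x + ∂ y
    ∂-*     : ∀ x y → ∂ (x * y) ≈ ∂ x * y + x * ∂ y

module DF {c ℓ} (H : DifferentialField c ℓ) where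
  open DifferentialField H public

  sum : ∀ {n} → (Fin n → Carrier) → Carrier
  sum = RM.sum +-rawMonoid

  ∂^ : ℕ → Carrier → Carrier
  ∂^ zero    x = x
  ∂^ (suc j) x = ∂ (∂^ j x)

  -- An element of H^v is a function Fin v → Carrier.
  -- X^j(x) = (x, ∂x, …, ∂^j x) ∈ H^{v(j+1)}, with coordinates indexed
  -- by (i , c) : Fin (suc j) × Fin v, the (i,c) coordinate being ∂^i (x c).
  jet : ∀ {v} (j : ℕ) → (Fin v → Carrier) → Fin (suc j) → Fin v → Carrier
  jet j x i c = ∂^ (toℕ i) (x c)

  CombZero : ∀ {m} {D : Set} → (Fin m → Carrier) → (Fin m → D → Carrier) → Set ℓ
  CombZero {D = D} λ′ y = ∀ (d : D) → sum (λ w → λ′ w * y w d) ≈ 0#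

  LinIndep : ∀ {m} {D : Set} → (Fin m → D → Carrier) → Set (c ⊔ ℓ)
  LinIndep y = ∀ λ′ → CombZero λ′ y → ∀ w → λ′ w ≈ 0#

  LinDep : ∀ {m} {D : Set} → (Fin m → D → Carrier) → Set (c ⊔ ℓ)
  LinDep y = Σ _ λ λ′ → (∃ λ w → ¬ (λ′ w ≈ 0#)) × CombZero λ′ y

  LinDepConst : ∀ {m} {D : Set} → (Fin m → D → Carrier) → Set (c ⊔ ℓ)
  LinDepConst y = Σ _ λ λ′ → (∀ w → ∂ (λ′ w) ≈ 0#)
                          × (∃ λ w → ¬ (λ′ w ≈ 0#)) × CombZero λ′ y

-- A relation Σ μ_w X^k_w = 0 restricts to the lower jets X^(k-1)_w; since the first s of these are
-- independent, μ_(s+1) ≠ 0 and we may normalise μ_(s+1) = 1. Differentiating the rows of order < k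
-- with the Leibniz rule and subtracting the rows of order ≤ k gives Σ ∂μ_w X^(k-1)_w = 0 with
-- ∂μ_(s+1) = ∂1 = 0, so independence forces every ∂μ_w to vanish.
module Submission where

open import Defs
open import Data.Nat using (ℕ; suc; _≤_; _∸_)
open import Data.Fin using (Fin; inject₁; fromℕ; toℕ)
open import Data.Fin.Properties using (toℕ-inject₁)
open import Data.Product using (Σ; _×_; _,_)
open import Function using (_∘_)
open import Relation.Binary.PropositionalEquality using (cong)
open import Relation.Nullary using (¬_)
import Algebra.Properties.Ring as RingProperties
import Algebra.Properties.Semiring.Sum as SemiringSum
import Relation.Binary.Reasoning.Setoid as SetoidReasoning

init-last-elim : ∀ {p n} (P : Fin (suc n) → Set p) →
                 (∀ i → P (inject₁ i)) → P (fromℕ n) → ∀ i → P i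
init-last-elim {n = 0}     P P-init P-last Fin.zero    = P-last
init-last-elim {n = suc n} P P-init P-last Fin.zero    = P-init Fin.zero
init-last-elim {n = suc n} P P-init P-last (Fin.suc i) =
  init-last-elim (P ∘ Fin.suc) (P-init ∘ Fin.suc) P-last i

module _ {c ℓ} (H : DifferentialField c ℓ) where
  open DF H
  open RingProperties ring using (x+x≈x⇒x≈0)
  open SemiringSum semiring using (sum-cong-≋; sum-init-last; ∑-distrib-+; *-distribˡ-sum)
  open SetoidReasoning setoid

  x+0≈0⇒x≈0 : ∀ {x} → x + 0# ≈ 0# → x ≈ 0#
  x+0≈0⇒x≈0 {x} x+0≈0 = trans (sym (+-identityʳ x)) x+0≈0

  ∂-0# : ∂ 0# ≈ 0#
  ∂-0# = x+x≈x⇒x≈0 (∂ 0#) (sym (trans (∂-cong (sym (+-identityʳ 0#))) (∂-+ 0# 0#)))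

  ∂-1# : ∂ 1# ≈ 0#
  ∂-1# = x+x≈x⇒x≈0 (∂ 1#) (sym (begin
    ∂ 1#                  ≈⟨ ∂-cong (sym (*-identityˡ 1#)) ⟩
    ∂ (1# * 1#)           ≈⟨ ∂-* 1# 1# ⟩
    ∂ 1# * 1# + 1# * ∂ 1# ≈⟨ +-cong (*-identityʳ (∂ 1#)) (*-identityˡ (∂ 1#)) ⟩
    ∂ 1# + ∂ 1#           ∎))

  ∂-sum : ∀ {n} (f : Fin n → Carrier) → ∂ (sum f) ≈ sum (∂ ∘ f)
  ∂-sum {0}     f = ∂-0#
  ∂-sum {suc n} f = trans (∂-+ _ _) (+-congˡ (∂-sum (f ∘ Fin.suc)))

  ∂-sum-* : ∀ {n} (f g : Fin n → Carrier) →
            ∂ (sum λ w → f w * g w) ≈ sum (λ w → ∂ (f w) * g w) + sum (λ w → f w * ∂ (g w))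
  ∂-sum-* f g = begin
    ∂ (sum λ w → f w * g w)                        ≈⟨ ∂-sum (λ w → f w * g w) ⟩
    sum (λ w → ∂ (f w * g w))                      ≈⟨ sum-cong-≋ (λ w → ∂-* (f w) (g w)) ⟩
    sum (λ w → ∂ (f w) * g w + f w * ∂ (g w))
      ≈⟨ ∑-distrib-+ (λ w → ∂ (f w) * g w) (λ w → f w * ∂ (g w)) ⟩
    sum (λ w → ∂ (f w) * g w) + sum (λ w → f w * ∂ (g w)) ∎

  CombZero-*ˡ : ∀ {m} {D : Set} {μ : Fin m → Carrier} {y : Fin m → D → Carrier} →
                ∀ b → CombZero μ y → CombZero (λ w → b * μ w) y
  CombZero-*ˡ {μ = μ} {y} b μy≈0 d = begin
    sum (λ w → (b * μ w) * y w d) ≈⟨ sum-cong-≋ (λ w → *-assoc b (μ w) (y w d)) ⟩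
    sum (λ w → b * (μ w * y w d)) ≈⟨ *-distribˡ-sum b (λ w → μ w * y w d) ⟨
    b * sum (λ w → μ w * y w d)   ≈⟨ *-congˡ (μy≈0 d) ⟩
    b * 0#                        ≈⟨ zeroʳ b ⟩
    0#                            ∎

  CombZero-normalise : ∀ {m} {D : Set} {μ : Fin m → Carrier} {y : Fin m → D → Carrier} {w} →
                       ¬ (μ w ≈ 0#) → CombZero μ y →
                       Σ (Fin m → Carrier) λ ν → ν w ≈ 1# × CombZero ν y
  CombZero-normalise {μ = μ} {y} {w} μw≉0 μy≈0 with inverse (μ w) μw≉0
  ... | b , μw*b≈1 = (λ u → b * μ u) , trans (*-comm b (μ w)) μw*b≈1 , CombZero-*ˡ {μ = μ} {y} b μy≈0

  CombZero-last≈0⇒≈0 : ∀ {s} {D : Set} (y : Fin (suc s) → D → Carrier) → LinIndep (y ∘ inject₁) →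
                       ∀ {μ} → CombZero μ y → μ (fromℕ s) ≈ 0# → ∀ w → μ w ≈ 0#
  CombZero-last≈0⇒≈0 {s} y indep {μ} μy≈0 μ-last≈0 =
    init-last-elim (λ w → μ w ≈ 0#) (indep (μ ∘ inject₁) init-vanishes) μ-last≈0
    where
    init-vanishes : CombZero (μ ∘ inject₁) (y ∘ inject₁)
    init-vanishes d = x+0≈0⇒x≈0 (begin
      sum (λ w → μ (inject₁ w) * y (inject₁ w) d) + 0#
        ≈⟨ +-congˡ (trans (*-congʳ μ-last≈0) (zeroˡ _)) ⟨
      sum (λ w → μ (inject₁ w) * y (inject₁ w) d) + μ (fromℕ s) * y (fromℕ s) d
        ≈⟨ sum-init-last (λ w → μ w * y w d) ⟨
      sum (λ w → μ w * y w d)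
        ≈⟨ μy≈0 d ⟩
      0# ∎)

  jets : ∀ {m v} (j : ℕ) → (Fin m → Fin v → Carrier) → Fin m → Fin (suc j) × Fin v → Carrier
  jets j x w (i , c′) = jet j (x w) i c′

  jet-inject₁ : ∀ {v} j (x : Fin v → Carrier) i c′ → jet (suc j) x (inject₁ i) c′ ≈ jet j x i c′
  jet-inject₁ j x i c′ = reflexive (cong (λ a → ∂^ a (x c′)) (toℕ-inject₁ i))

  CombZero-jets-lower : ∀ {m v j} {x : Fin m → Fin v → Carrier} {μ} →
                        CombZero μ (jets (suc j) x) → CombZero μ (jets j x)
  CombZero-jets-lower {x = x} {μ} μX≈0 (i , c′) =
    trans (sum-cong-≋ (λ w → *-congˡ (sym (jet-inject₁ _ (x w) i c′)))) (μX≈0 (inject₁ i , c′))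

  -- Row i of  ∂(Σ μ_w X^(j+1)_w) = 0  is  Σ ∂μ_w ∂^i x_w + (row i+1 of Σ μ_w X^(j+1)_w) = 0.
  CombZero-jets-∂ : ∀ {m v j} {x : Fin m → Fin v → Carrier} {μ} →
                    CombZero μ (jets (suc j) x) → CombZero (∂ ∘ μ) (jets j x)
  CombZero-jets-∂ {x = x} {μ} μX≈0 (i , c′) = x+0≈0⇒x≈0 (begin
    sum (λ w → ∂ (μ w) * a w) + 0#
      ≈⟨ +-congˡ (μX≈0 (Fin.suc i , c′)) ⟨
    sum (λ w → ∂ (μ w) * a w) + sum (λ w → μ w * ∂ (a w))
      ≈⟨ ∂-sum-* μ a ⟨
    ∂ (sum λ w → μ w * a w)
      ≈⟨ ∂-cong (CombZero-jets-lower {x = x} {μ} μX≈0 (i , c′)) ⟩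
    ∂ 0#
      ≈⟨ ∂-0# ⟩
    0# ∎)
    where
    a : _ → Carrier
    a w = ∂^ (toℕ i) (x w c′)

  LinDep-jets⇒LinDepConst : ∀ {s v k} (x : Fin (suc s) → Fin v → Carrier) →
                            LinIndep (jets k (x ∘ inject₁)) → LinDep (jets (suc k) x) →
                            LinDepConst (jets (suc k) x)
  LinDep-jets⇒LinDepConst {s} {k = k} x indep (λ′ , (w₀ , λ′w₀≉0) , λ′X≈0) =
    let μ , μ-last≈1 , μX≈0 = CombZero-normalise {μ = λ′} {jets (suc k) x} λ′-last≉0 λ′X≈0
        μ-last≉0 : ¬ (μ (fromℕ s) ≈ 0#)
        μ-last≉0 μ-last≈0 = 0≉1 (trans (sym μ-last≈0) μ-last≈1)
    in μ , vanishes (CombZero-jets-∂ {x = x} {μ} μX≈0) (trans (∂-cong μ-last≈1) ∂-1#)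
         , (fromℕ s , μ-last≉0) , μX≈0
    where
    vanishes : ∀ {μ} → CombZero μ (jets k x) → μ (fromℕ s) ≈ 0# → ∀ w → μ w ≈ 0#
    vanishes = CombZero-last≈0⇒≈0 (jets k x) indep
    λ′-last≉0 : ¬ (λ′ (fromℕ s) ≈ 0#)
    λ′-last≉0 λ′-last≈0 = λ′w₀≉0 (vanishes (CombZero-jets-lower {x = x} {λ′} λ′X≈0) λ′-last≈0 w₀)

propositionI6 : ∀ {c ℓ} (H : DifferentialField c ℓ) → let open DF H in
    (k s v : ℕ) → 1 ≤ k → 1 ≤ s → 1 ≤ v →
    (x : Fin (suc s) → Fin v → Carrier) →
    LinIndep (λ (w : Fin s) → λ ((i , c′) : Fin (suc (k ∸ 1)) × Fin v) → jet (k ∸ 1) (x (inject₁ w)) i c′) →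
    LinDep (λ (w : Fin (suc s)) → λ ((i , c′) : Fin (suc k) × Fin v) → jet k (x w) i c′) →
    LinDepConst (λ (w : Fin (suc s)) → λ ((i , c′) : Fin (suc k) × Fin v) → jet k (x w) i c′)
propositionI6 H (suc k) s v _ _ _ = LinDep-jets⇒LinDepConst H
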